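{- Let $c:[m]\times[n]\to[k]$ be a colouring onto $[k]$ and $P(c)=\{c^{ -1}(\{i\}) : i\in[k]\}$. Let $P$ be a partition of $[m]\times[n]$ with $P(c)\sqsubseteq P$, and for each $K\in P(c)$ let $G_K$ be a simple undirected graph with vertex set $\{p\in P: p\subseteq K\}$. Consider the following operations on a pair (partition, family of graphs $\{G_K\}_{K\in P(c)}$): (i) add an edge between two vertices of some $G_K$; (ii) for some $K$ and two distinct non-adjacent vertices $p_1,p_2$ of $G_K$, replace $p_1,p_2$ in the partition by $p_1\cup p_2$ and merge the vertices $p_1,p_2$ of $G_K$ into a single vertex $p_1\cup p_2$ whose neighbourhood is the union of the neighbourhoods of $p_1$ and $p_2$. Then every partition $P'$ obtained from $(P,\{G_K\})$ by a finite sequence of such operations satisfies $\sum_{K\in P(c)}\chi(G_K)\le|P'|$, where $\chi$ denotes the chromatic number.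
   Context: For partitions $Q,Q'$ of $[m]\times[n]$, $Q\sqsubseteq Q'$ means every part of $Q'$ is contained in some part of $Q$. -}

module Defs where

open import Data.Nat using (ℕ; suc; _≤_)
open import Data.Fin using (Fin; punchOut; _≟_)
open import Data.Product using (Σ; ∃; _×_; _,_)
open import Data.Sum using (_⊎_)
open import Data.List using (tabulate)
open import Data.Nat.ListAction using (sum)
open import Relation.Nullary using (¬_; yes; no)
open import Relation.Binary.PropositionalEquality using (_≡_; _≢_; sym)
open import Function using (_∘_)

Cell : ℕ → ℕ → Set
Cell m n = Fin m × Fin n

Surj : {A B : Set} → (A → B) → Set
Surj {A} {B} f = ∀ (y : B) → ∃ λ (x : A) → f x ≡ y

Colourable : (V : Set) → (V → V → Set) → ℕ → Set
Colourable V adj t =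
  ∃ λ (col : V → Fin t) → ∀ u v → adj u v → col u ≢ col v

IsChromaticNumber : (V : Set) → (V → V → Set) → ℕ → Set
IsChromaticNumber V adj t =
  Colourable V adj t × (∀ s → Colourable V adj s → t ≤ s)

-- States: a partition of [m]×[n] into N (nonempty) parts, encoded by a
-- surjective labelling  part : Cell m n → Fin N  (part p = fibre of p),
-- together with the family of graphs {G_K}, encoded by one adjacency
-- relation on the parts (G_K is its restriction to parts ⊆ K).

record State (m n : ℕ) : Set₁ where
  constructor st
  field
    N    : ℕ
    part : Cell m n → Fin N
    adj  : Fin N → Fin N → Set

module _ {m n k : ℕ} (c : Cell m n → Fin k) where

  PartIn : {N : ℕ} → (Cell m n → Fin N) → Fin N → Fin k → Set
  PartIn part p K = ∀ x → part x ≡ p → c x ≡ K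

  Vert : State m n → Fin k → Set
  Vert S K = Σ (Fin (State.N S)) λ p → PartIn (State.part S) p K

  G : (S : State m n) → (K : Fin k) → Vert S K → Vert S K → Set
  G S K (p , _) (q , _) = State.adj S p q

  addE : {N : ℕ} → (Fin N → Fin N → Set) → Fin N → Fin N → Fin N → Fin N → Set
  addE E p q a b = E a b ⊎ ((a ≡ p × b ≡ q) ⊎ (a ≡ q × b ≡ p))

  -- relabelling of parts when part p₂ is merged into part p₁:
  -- p₂ ↦ (new label of p₁), every other label is punched out around p₂.
  mergeMap : {N : ℕ} (p₁ p₂ : Fin (suc N)) → p₁ ≢ p₂ → Fin (suc N) → Fin N
  mergeMap p₁ p₂ ne x with x ≟ p₂
  ... | yes _  = punchOut {i = p₂} {j = p₁} (ne ∘ sym)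
  ... | no x≢p = punchOut {i = p₂} {j = x} (x≢p ∘ sym)

  mergeE : {N : ℕ} (p₁ p₂ : Fin (suc N)) → p₁ ≢ p₂ →
           (Fin (suc N) → Fin (suc N) → Set) → Fin N → Fin N → Set
  mergeE p₁ p₂ ne E a b =
    ∃ λ x → ∃ λ y → mergeMap p₁ p₂ ne x ≡ a × mergeMap p₁ p₂ ne y ≡ b × E x y

  data Step : State m n → State m n → Set₁ where
    addEdge : ∀ N (part : Cell m n → Fin N) (E : Fin N → Fin N → Set)
              (K : Fin k) (p q : Fin N) → p ≢ q →
              PartIn part p K → PartIn part q K →
              Step (st N part E) (st N part (addE E p q))
    merge   : ∀ N (part : Cell m n → Fin (suc N)) (E : Fin (suc N) → Fin (suc N) → Set)
              (K : Fin k) (p₁ p₂ : Fin (suc N)) (ne : p₁ ≢ p₂) →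
              PartIn part p₁ K → PartIn part p₂ K → ¬ E p₁ p₂ →
              Step (st (suc N) part E)
                   (st N (mergeMap p₁ p₂ ne ∘ part) (mergeE p₁ p₂ ne E))

  data Reach : State m n → State m n → Set₁ where
    done : ∀ S → Reach S S
    step : ∀ {S T U} → Step S T → Reach T U → Reach S U

  sumFin : (Fin k → ℕ) → ℕ
  sumFin χ = sum (tabulate χ)

module Submission where

open import Defs
open import Data.Nat using (ℕ; _≤_; _<_; zero; suc; _+_; z≤n)
open import Data.Nat.Properties
  using (≤-refl; ≤-reflexive; <-≤-trans; <-irrefl; +-suc; +-mono-≤; n≤1+n;
         module ≤-Reasoning)
open import Data.Fin using (Fin; punchIn; fromℕ<)
  renaming (zero to fzero; suc to fsuc; _≟_ to _≟ᶠ_)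
open import Data.Fin.Properties
  using (punchOut-injective; punchOut-cong; punchInᵢ≢i; punchOut-punchIn; fromℕ<-injective)
open import Data.Vec.Functional using (updateAt)
open import Data.Vec.Functional.Properties using (updateAt-updates)
open import Data.Product using (∃; _×_; _,_; proj₁; proj₂)
open import Data.Sum using (_⊎_; inj₁; inj₂)
open import Data.List using (tabulate)
open import Data.Nat.ListAction using (sum)
open import Function using (_∘_)
open import Relation.Nullary using (¬_; yes; no; contradiction)
open import Relation.Binary.PropositionalEquality
  using (_≡_; _≢_; refl; sym; trans; cong; subst; subst₂)

-- Every edge of the initial graphs survives, as an edge between the final parts
-- containing its end cells, and the final adjacency stays irreflexive.  So
-- sending a vertex of G_K to its final part properly colours G_K with the final
-- parts lying in K, whence χ(G_K) is at most their number; summing over K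
-- gives the bound, since every final part lies in a single colour class.

sum-tabulate-0 : ∀ k → sum (tabulate {n = k} (λ _ → 0)) ≡ 0
sum-tabulate-0 zero    = refl
sum-tabulate-0 (suc k) = sum-tabulate-0 k

sum-tabulate-mono : ∀ {k} (f g : Fin k → ℕ) → (∀ K → f K ≤ g K) →
                    sum (tabulate f) ≤ sum (tabulate g)
sum-tabulate-mono {zero}  f g f≤g = z≤n
sum-tabulate-mono {suc k} f g f≤g =
  +-mono-≤ (f≤g fzero) (sum-tabulate-mono (f ∘ fsuc) (g ∘ fsuc) (f≤g ∘ fsuc))

sum-tabulate-updateAt-suc : ∀ {k} (f : Fin k → ℕ) j →
                            sum (tabulate (updateAt f j suc)) ≡ suc (sum (tabulate f))
sum-tabulate-updateAt-suc f fzero    = refl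
sum-tabulate-updateAt-suc f (fsuc j) =
  trans (cong (f fzero +_) (sum-tabulate-updateAt-suc (f ∘ fsuc) j)) (+-suc (f fzero) _)

≤-updateAt-suc : ∀ {k} (f : Fin k → ℕ) j K → f K ≤ updateAt f j suc K
≤-updateAt-suc f fzero    fzero    = n≤1+n _
≤-updateAt-suc f fzero    (fsuc K) = ≤-refl
≤-updateAt-suc f (fsuc j) fzero    = ≤-refl
≤-updateAt-suc f (fsuc j) (fsuc K) = ≤-updateAt-suc (f ∘ fsuc) j K

record FibreRanking {N k : ℕ} (cls : Fin N → Fin k) : Set where
  field
    size           : Fin k → ℕ
    sum-size       : sum (tabulate size) ≡ N
    rank           : Fin N → ℕ
    rank<size      : ∀ p → rank p < size (cls p)
    rank-injective : ∀ p q → cls p ≡ cls q → rank p ≡ rank q → p ≡ q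

fibreRanking : ∀ {N k} (cls : Fin N → Fin k) → FibreRanking cls
fibreRanking {zero} {k} cls = record
  { size = λ _ → 0 ; sum-size = sum-tabulate-0 k
  ; rank = λ () ; rank<size = λ () ; rank-injective = λ () }
fibreRanking {suc N} cls = record
  { size           = size
  ; sum-size       = trans (sum-tabulate-updateAt-suc R.size (cls fzero))
                           (cong suc R.sum-size)
  ; rank           = rank
  ; rank<size      = rank<size
  ; rank-injective = rank-injective
  }
  where
  module R = FibreRanking (fibreRanking (cls ∘ fsuc))

  size : _ → ℕ
  size = updateAt R.size (cls fzero) suc

  rank : Fin (suc N) → ℕ
  rank fzero    = R.size (cls fzero)
  rank (fsuc p) = R.rank p

  rank<size : ∀ p → rank p < size (cls p)
  rank<size fzero    = ≤-reflexive (sym (updateAt-updates (cls fzero) R.size))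
  rank<size (fsuc p) = <-≤-trans (R.rank<size p) (≤-updateAt-suc R.size (cls fzero) _)

  fresh : ∀ q → cls fzero ≡ cls (fsuc q) → R.size (cls fzero) ≢ R.rank q
  fresh q same r≡ =
    <-irrefl (sym r≡) (subst (λ K → R.rank q < R.size K) (sym same) (R.rank<size q))

  rank-injective : ∀ p q → cls p ≡ cls q → rank p ≡ rank q → p ≡ q
  rank-injective fzero    fzero    _    _  = refl
  rank-injective fzero    (fsuc q) same r≡ = contradiction r≡ (fresh q same)
  rank-injective (fsuc p) fzero    same r≡ = contradiction (sym r≡) (fresh p (sym same))
  rank-injective (fsuc p) (fsuc q) same r≡ = cong fsuc (R.rank-injective p q same r≡)

module _ {m n k : ℕ} (c : Cell m n → Fin k) where

  addE-symmetric : ∀ {N} (E : Fin N → Fin N → Set) p q → (∀ a b → E a b → E b a) →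
                   ∀ a b → addE c E p q a b → addE c E p q b a
  addE-symmetric E p q E-sym a b (inj₁ e)                  = inj₁ (E-sym a b e)
  addE-symmetric E p q E-sym a b (inj₂ (inj₁ (a≡p , b≡q))) = inj₂ (inj₂ (b≡q , a≡p))
  addE-symmetric E p q E-sym a b (inj₂ (inj₂ (a≡q , b≡p))) = inj₂ (inj₁ (b≡p , a≡q))

  addE-irreflexive : ∀ {N} (E : Fin N → Fin N → Set) p q → p ≢ q →
                     (∀ a → ¬ E a a) → ∀ a → ¬ addE c E p q a a
  addE-irreflexive E p q p≢q E-irr a (inj₁ e)                  = E-irr a e
  addE-irreflexive E p q p≢q E-irr a (inj₂ (inj₁ (a≡p , a≡q))) = p≢q (trans (sym a≡p) a≡q)
  addE-irreflexive E p q p≢q E-irr a (inj₂ (inj₂ (a≡q , a≡p))) = p≢q (trans (sym a≡p) a≡q)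

  Merged : ∀ {N} → Fin N → Fin N → Fin N → Set
  Merged p₁ p₂ u = u ≡ p₁ ⊎ u ≡ p₂

  module _ {N : ℕ} (p₁ p₂ : Fin (suc N)) (p₁≢p₂ : p₁ ≢ p₂) where

    private
      merged = mergeMap c p₁ p₂ p₁≢p₂

    mergeMap-injective-or-merged : ∀ u v → merged u ≡ merged v →
                                   u ≡ v ⊎ (Merged p₁ p₂ u × Merged p₁ p₂ v)
    mergeMap-injective-or-merged u v eq with u ≟ᶠ p₂ | v ≟ᶠ p₂
    ... | yes u≡p₂ | yes v≡p₂ = inj₁ (trans u≡p₂ (sym v≡p₂))
    ... | yes u≡p₂ | no  v≢p₂ =
      inj₂ (inj₂ u≡p₂ , inj₁ (sym (punchOut-injective (p₁≢p₂ ∘ sym) (v≢p₂ ∘ sym) eq)))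
    ... | no  u≢p₂ | yes v≡p₂ =
      inj₂ (inj₁ (punchOut-injective (u≢p₂ ∘ sym) (p₁≢p₂ ∘ sym) eq) , inj₂ v≡p₂)
    ... | no  u≢p₂ | no  v≢p₂ = inj₁ (punchOut-injective (u≢p₂ ∘ sym) (v≢p₂ ∘ sym) eq)

    mergeMap-punchIn : ∀ a → merged (punchIn p₂ a) ≡ a
    mergeMap-punchIn a with punchIn p₂ a ≟ᶠ p₂
    ... | yes eq = contradiction eq (punchInᵢ≢i p₂ a)
    ... | no  _  = trans (punchOut-cong p₂ refl) (punchOut-punchIn p₂)

    mergeE-symmetric : (E : Fin (suc N) → Fin (suc N) → Set) →
                       (∀ a b → E a b → E b a) →
                       ∀ a b → mergeE c p₁ p₂ p₁≢p₂ E a b → mergeE c p₁ p₂ p₁≢p₂ E b a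
    mergeE-symmetric E E-sym a b (x , y , x↦a , y↦b , e) =
      y , x , y↦b , x↦a , E-sym x y e

    mergeE-irreflexive : (E : Fin (suc N) → Fin (suc N) → Set) →
                         (∀ a b → E a b → E b a) → (∀ a → ¬ E a a) → ¬ E p₁ p₂ →
                         ∀ a → ¬ mergeE c p₁ p₂ p₁≢p₂ E a a
    mergeE-irreflexive E E-sym E-irr ¬E₁₂ a (x , y , x↦a , y↦a , e)
      with mergeMap-injective-or-merged x y (trans x↦a (sym y↦a))
    ... | inj₁ refl                    = E-irr x e
    ... | inj₂ (inj₁ refl , inj₁ refl) = E-irr x e
    ... | inj₂ (inj₁ refl , inj₂ refl) = ¬E₁₂ e
    ... | inj₂ (inj₂ refl , inj₁ refl) = ¬E₁₂ (E-sym x y e)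
    ... | inj₂ (inj₂ refl , inj₂ refl) = E-irr x e

  record Valid (S : State m n) : Set where
    open State S
    field
      part-surjective    : Surj part
      part-monochromatic : ∀ x y → part x ≡ part y → c x ≡ c y
      adj-symmetric      : ∀ p q → adj p q → adj q p
      adj-irreflexive    : ∀ p → ¬ adj p p

  EdgesPersist : State m n → State m n → Set
  EdgesPersist S T = ∀ x y → State.adj S (State.part S x) (State.part S y)
                           → State.adj T (State.part T x) (State.part T y)

  Step-valid : ∀ {S T} → Step c S T → Valid S → Valid T
  Step-valid (addEdge N part E K p q p≢q _ _) v = record
    { part-surjective    = part-surjective
    ; part-monochromatic = part-monochromatic
    ; adj-symmetric      = addE-symmetric E p q adj-symmetric
    ; adj-irreflexive    = addE-irreflexive E p q p≢q adj-irreflexive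
    }
    where open Valid v
  Step-valid (merge N part E K p₁ p₂ p₁≢p₂ p₁⊆K p₂⊆K ¬E₁₂) v = record
    { part-surjective    = merged-surjective
    ; part-monochromatic = merged-monochromatic
    ; adj-symmetric      = mergeE-symmetric p₁ p₂ p₁≢p₂ E adj-symmetric
    ; adj-irreflexive    =
        mergeE-irreflexive p₁ p₂ p₁≢p₂ E adj-symmetric adj-irreflexive ¬E₁₂
    }
    where
    open Valid v
    merged = mergeMap c p₁ p₂ p₁≢p₂

    merged-surjective : Surj (merged ∘ part)
    merged-surjective a with part-surjective (punchIn p₂ a)
    ... | x , x∈ = x , trans (cong merged x∈) (mergeMap-punchIn p₁ p₂ p₁≢p₂ a)

    Merged⊆K : ∀ x → Merged p₁ p₂ (part x) → c x ≡ K
    Merged⊆K x (inj₁ x∈p₁) = p₁⊆K x x∈p₁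
    Merged⊆K x (inj₂ x∈p₂) = p₂⊆K x x∈p₂

    merged-monochromatic : ∀ x y → merged (part x) ≡ merged (part y) → c x ≡ c y
    merged-monochromatic x y eq
      with mergeMap-injective-or-merged p₁ p₂ p₁≢p₂ (part x) (part y) eq
    ... | inj₁ same      = part-monochromatic x y same
    ... | inj₂ (x∈ , y∈) = trans (Merged⊆K x x∈) (sym (Merged⊆K y y∈))

  Step-edgesPersist : ∀ {S T} → Step c S T → EdgesPersist S T
  Step-edgesPersist (addEdge N part E K p q _ _ _)   x y   = inj₁
  Step-edgesPersist (merge N part E K p₁ p₂ _ _ _ _) x y e = part x , part y , refl , refl , e

  Reach-valid : ∀ {S T} → Reach c S T → Valid S → Valid T
  Reach-valid (done S)   v = v
  Reach-valid (step s r) v = Reach-valid r (Step-valid s v)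

  Reach-edgesPersist : ∀ {S T} → Reach c S T → EdgesPersist S T
  Reach-edgesPersist (done S)   x y e = e
  Reach-edgesPersist (step s r) x y e = Reach-edgesPersist r x y (Step-edgesPersist s x y e)

  module FinalPartColouring {S T : State m n} (S-surjective : Surj (State.part S))
                            (T-valid : Valid T) (persist : EdgesPersist S T) where

    open Valid T-valid

    classOf : Fin (State.N T) → Fin k
    classOf p = c (proj₁ (part-surjective p))

    classOf-part : ∀ x → classOf (State.part T x) ≡ c x
    classOf-part x = part-monochromatic _ x (proj₂ (part-surjective (State.part T x)))

    open FibreRanking (fibreRanking classOf) public

    colourable : ∀ K → Colourable (Vert c S K) (G c S K) (size K)
    colourable K = colour , proper
      where
      cell : Vert c S K → Cell m n
      cell (p , _) = proj₁ (S-surjective p)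

      final : Vert c S K → Fin (State.N T)
      final v = State.part T (cell v)

      final⊆K : ∀ v → classOf (final v) ≡ K
      final⊆K (p , p⊆K) = trans (classOf-part _) (p⊆K _ (proj₂ (S-surjective p)))

      rank<sizeK : ∀ v → rank (final v) < size K
      rank<sizeK v =
        subst (λ K → rank (final v) < size K) (final⊆K v) (rank<size (final v))

      colour : Vert c S K → Fin (size K)
      colour v = fromℕ< (rank<sizeK v)

      final-edge : ∀ u v → G c S K u v → State.adj T (final u) (final v)
      final-edge (p , _) (q , _) e =
        persist _ _ (subst₂ (State.adj S) (sym (proj₂ (S-surjective p)))
                                          (sym (proj₂ (S-surjective q))) e)

      proper : ∀ u v → G c S K u v → colour u ≢ colour v
      proper u v e same-colour =
        adj-irreflexive (final u)
          (subst (State.adj T (final u)) (sym same-final) (final-edge u v e))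
        where
        same-final : final u ≡ final v
        same-final = rank-injective _ _ (trans (final⊆K u) (sym (final⊆K v)))
                       (fromℕ<-injective _ _ (rank<sizeK u) (rank<sizeK v) same-colour)

proposition3 : (m n k : ℕ) (c : Cell m n → Fin k) → Surj c →
    (N : ℕ) (part : Cell m n → Fin N) → Surj part →
    (∀ (p : Fin N) → ∃ λ (K : Fin k) → PartIn c part p K) →
    (E : Fin N → Fin N → Set) →
    (∀ p q → E p q → E q p) →
    (∀ p → ¬ E p p) →
    (∀ p q (K : Fin k) → E p q → PartIn c part p K → PartIn c part q K) →
    (S' : State m n) → Reach c (st N part E) S' →
    (χ : Fin k → ℕ) →
    (∀ K → IsChromaticNumber (Vert c (st N part E) K) (G c (st N part E) K) (χ K)) →
    sumFin c χ ≤ State.N S'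
proposition3 m n k c _ N part part-surjective part-in-class E E-sym E-irr _
             S' reach χ χ-chromatic =
  begin
    sum (tabulate χ)    ≤⟨ sum-tabulate-mono χ size χ≤size ⟩
    sum (tabulate size) ≡⟨ sum-size ⟩
    State.N S'          ∎
  where
  open ≤-Reasoning

  initial-valid : Valid c (st N part E)
  initial-valid = record
    { part-surjective    = part-surjective
    ; part-monochromatic = λ x y same → let (K , p⊆K) = part-in-class (part x)
                                        in trans (p⊆K x refl) (sym (p⊆K y (sym same)))
    ; adj-symmetric      = E-sym
    ; adj-irreflexive    = E-irr
    }

  open FinalPartColouring c {S = st N part E} part-surjective
         (Reach-valid c reach initial-valid) (Reach-edgesPersist c reach)

  χ≤size : ∀ K → χ K ≤ size K
  χ≤size K = proj₂ (χ-chromatic K) (size K) (colourable K)
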